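{- Let $n\ge 1$ and let $G_n$ be a caterpillar graph with central path $P_n=v_1v_2\cdots v_n$ such that every vertex $v_i$ of $P_n$ satisfies $l(v_i)=2$. Then $\lambda_H(G_n)=n$.
   Context: A caterpillar graph $G_n$ is a tree containing a path $P_n$ on $n$ vertices (its central path) such that every vertex of $G_n$ is at distance at most $1$ from $P_n$; every vertex of $G_n$ not on $P_n$ is a leaf (vertex of degree $1$) adjacent to a vertex of $P_n$. For a vertex $v$, $l(v)$ denotes the number of leaves adjacent to $v$. For a graph $G$, the Hamiltonian complete number $\lambda_H(G)$ is the minimum number of edges not in $E(G)$, joining vertices of $G$, whose addition to $G$ produces a graph containing a Hamiltonian (spanning) cycle. -}

module Defs where

open import Data.Nat using (ℕ; zero; suc; _≤_)
open import Data.Fin using (Fin; zero; suc; toℕ; inject₁; fromℕ)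
open import Data.Product using (Σ; Σ-syntax; ∃; ∃-syntax; _×_; _,_)
open import Data.Sum using (_⊎_)
open import Data.List using (List; length)
open import Data.List.Membership.Propositional using (_∈_)
open import Data.List.Relation.Unary.All using (All)
open import Data.List.Relation.Unary.AllPairs using (AllPairs)
open import Relation.Nullary using (¬_)
open import Relation.Binary.PropositionalEquality using (_≡_; _≢_)
open import Function.Definitions using (Injective)

record SimpleGraph (N : ℕ) : Set₁ where
  field
    Adj   : Fin N → Fin N → Set
    sym   : ∀ {u v} → Adj u v → Adj v u
    irrefl : ∀ {u} → ¬ Adj u u
open SimpleGraph public

data Walk {N : ℕ} (A : Fin N → Fin N → Set) : Fin N → Fin N → Set where
  here  : ∀ {u} → Walk A u u
  step  : ∀ {u v w} → A u v → Walk A v w → Walk A u w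

IsCycle : {N : ℕ} (A : Fin N → Fin N → Set) {m : ℕ} → (Fin (suc m) → Fin N) → Set
IsCycle A {m} c =
  2 ≤ m × Injective _≡_ _≡_ c
    × (∀ (i : Fin m) → A (c (inject₁ i)) (c (suc i)))
    × A (c (fromℕ m)) (c zero)

Hamiltonian : {N : ℕ} (A : Fin N → Fin N → Set) → Set
Hamiltonian {N} A =
  Σ[ m ∈ ℕ ] Σ[ c ∈ (Fin (suc m) → Fin N) ]
    IsCycle A c × (∀ (v : Fin N) → ∃[ i ] c i ≡ v)

Connected : {N : ℕ} → SimpleGraph N → Set
Connected {N} G = ∀ (u v : Fin N) → Walk (Adj G) u v

Acyclic : {N : ℕ} → SimpleGraph N → Set
Acyclic {N} G = ∀ (m : ℕ) (c : Fin (suc m) → Fin N) → ¬ IsCycle (Adj G) c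

IsTree : {N : ℕ} → SimpleGraph N → Set
IsTree G = Connected G × Acyclic G

IsLeaf : {N : ℕ} → SimpleGraph N → Fin N → Set
IsLeaf {N} G v = Σ[ u ∈ Fin N ] Adj G v u × (∀ w → Adj G v w → w ≡ u)

TwoLeaves : {N : ℕ} → SimpleGraph N → Fin N → Set
TwoLeaves {N} G v =
  Σ[ a ∈ Fin N ] Σ[ b ∈ Fin N ]
    a ≢ b × IsLeaf G a × IsLeaf G b × Adj G v a × Adj G v b
    × (∀ w → Adj G v w → IsLeaf G w → (w ≡ a) ⊎ (w ≡ b))

IsCaterpillar : {N : ℕ} → SimpleGraph N → (n : ℕ) → (Fin n → Fin N) → Set
IsCaterpillar {N} G n p =
  IsTree G × Injective _≡_ _≡_ p
    × (∀ (i j : Fin n) → suc (toℕ i) ≡ toℕ j → Adj G (p i) (p j))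
    × (∀ (v : Fin N) → (∀ i → p i ≢ v) → IsLeaf G v × (∃[ i ] Adj G v (p i)))

SameEdge : {N : ℕ} → Fin N × Fin N → Fin N × Fin N → Set
SameEdge (a , b) (c , d) = (a ≡ c × b ≡ d) ⊎ (a ≡ d × b ≡ c)

ValidAddition : {N : ℕ} → SimpleGraph N → List (Fin N × Fin N) → Set
ValidAddition G F =
  All (λ { (a , b) → a ≢ b × ¬ Adj G a b }) F × AllPairs (λ e f → ¬ SameEdge e f) F

AddEdges : {N : ℕ} → SimpleGraph N → List (Fin N × Fin N) → Fin N → Fin N → Set
AddEdges G F a b = Adj G a b ⊎ ((a , b) ∈ F ⊎ (b , a) ∈ F)

HamCompletionNumber : {N : ℕ} → SimpleGraph N → ℕ → Set
HamCompletionNumber {N} G k =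
  (Σ[ F ∈ List (Fin N × Fin N) ]
     ValidAddition G F × length F ≡ k × Hamiltonian (AddEdges G F))
  × (∀ (F : List (Fin N × Fin N)) → ValidAddition G F
       → Hamiltonian (AddEdges G F) → k ≤ length F)

-- A leaf has one edge in G but two on any Hamiltonian cycle, so every leaf is an endpoint of an
-- added edge, and covering the 2n leaves takes at least n added edges. Conversely, with a_i, b_i
-- the leaves at v_i, the n edges b_i a_(i+1) (indices mod n) close the spanning cycle
-- a_1 v_1 b_1 a_2 v_2 b_2 ⋯ a_n v_n b_n.
module Submission where

open import Defs
open import Data.Nat using (ℕ; zero; suc; _+_; _*_; _≤_; _<_; z≤n; s≤s; _%_; NonZero)
open import Data.Nat.Properties
  using (*-cancelʳ-≤; *-cancelʳ-<; *-monoˡ-≤; +-mono-≤; m≤n+m; ≤-<-trans;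
         +-commutativeSemigroup)
open import Algebra.Properties.CommutativeSemigroup +-commutativeSemigroup
  using (x∙yz≈y∙xz)
open import Data.Nat.DivMod using (_mod_; %-distribˡ-+; m%n%n≡m%n; m<n⇒m%n≡m; n%n≡0)
open import Data.Fin using (Fin; zero; suc; toℕ; inject₁; fromℕ; fromℕ<; combine; remQuot)
open import Data.Fin.Patterns using (0F; 1F; 2F)
open import Data.Fin.Properties
  using (toℕ-injective; toℕ-inject₁; toℕ-fromℕ; toℕ-fromℕ<; toℕ≤pred[n]; suc-injective;
         toℕ<n; injective⇒≤; combine-injective; combine-remQuot; any?; _≟_)
open import Data.Product using (Σ-syntax; ∃-syntax; _×_; _,_; proj₁; proj₂; uncurry)
open import Data.Sum using (_⊎_; inj₁; inj₂)
open import Data.List using (List; length; lookup; tabulate)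
open import Data.List.Properties using (length-tabulate)
open import Data.List.Membership.Propositional using (_∈_)
open import Data.List.Membership.Propositional.Properties using (∈-tabulate⁺)
import Data.List.Relation.Unary.Any as Any
open import Data.List.Relation.Unary.Any.Properties using (lookup-index)
import Data.List.Relation.Unary.All.Properties as All
import Data.List.Relation.Unary.AllPairs.Properties as AllPairs
open import Data.Empty using (⊥-elim)
open import Relation.Nullary using (¬_; yes; no)
open import Relation.Binary.PropositionalEquality
  using (_≡_; _≢_; refl; trans; cong; cong₂; subst; module ≡-Reasoning)
  renaming (sym to ≡-sym)
open import Function.Definitions using (Injective)

fromℕ-or-inject₁ : ∀ {m} (k : Fin (suc m))
  → k ≡ fromℕ m ⊎ Σ[ k′ ∈ Fin m ] k ≡ inject₁ k′
fromℕ-or-inject₁ {zero}  zero    = inj₁ refl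
fromℕ-or-inject₁ {suc m} zero    = inj₂ (zero , refl)
fromℕ-or-inject₁ {suc m} (suc k) with fromℕ-or-inject₁ k
... | inj₁ k≡last      = inj₁ (cong suc k≡last)
... | inj₂ (k′ , k≡k′) = inj₂ (suc k′ , cong suc k≡k′)

inject₁²≢suc² : ∀ {m} (k : Fin m) → inject₁ (inject₁ k) ≢ suc (suc k)
inject₁²≢suc² zero    ()
inject₁²≢suc² (suc k) e = inject₁²≢suc² k (suc-injective e)

IsCycle-two-neighbours : ∀ {N} {A : Fin N → Fin N → Set} → (∀ {x y} → A x y → A y x)
  → ∀ {m} (c : Fin (suc m) → Fin N) → IsCycle A c → ∀ j
  → Σ[ u ∈ Fin (suc m) ] Σ[ w ∈ Fin (suc m) ] u ≢ w × A (c j) (c u) × A (c j) (c w)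
IsCycle-two-neighbours A-sym {suc (suc m)} c (s≤s (s≤s z≤n) , _ , adj , close) zero =
  1F , fromℕ (suc (suc m)) , (λ ()) , adj zero , A-sym close
IsCycle-two-neighbours A-sym {suc (suc m)} c (s≤s (s≤s z≤n) , _ , adj , close) (suc k)
  with fromℕ-or-inject₁ k
... | inj₁ refl        = inject₁ k , zero , (λ ()) , A-sym (adj k) , close
... | inj₂ (k′ , refl) =
  inject₁ k , suc (suc k′) , inject₁²≢suc² k′ , A-sym (adj k) , adj (suc k′)

AddEdges-sym : ∀ {N} (G : SimpleGraph N) F {x y} → AddEdges G F x y → AddEdges G F y x
AddEdges-sym G F (inj₁ xy)        = inj₁ (SimpleGraph.sym G xy)
AddEdges-sym G F (inj₂ (inj₁ xy)) = inj₂ (inj₂ xy)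
AddEdges-sym G F (inj₂ (inj₂ yx)) = inj₂ (inj₁ yx)

leaf-neighbour-unique : ∀ {N} (G : SimpleGraph N) {x y z}
  → IsLeaf G x → Adj G x y → Adj G x z → y ≡ z
leaf-neighbour-unique G (_ , _ , only) xy xz = trans (only _ xy) (≡-sym (only _ xz))

endpoint : ∀ {A : Set} (F : List (A × A)) → Fin (length F) × Fin 2 → A
endpoint F (k , 0F) = proj₁ (lookup F k)
endpoint F (k , 1F) = proj₂ (lookup F k)

∈-endpoint : ∀ {A : Set} {F : List (A × A)} {x z}
  → (x , z) ∈ F ⊎ (z , x) ∈ F → ∃[ e ] endpoint F e ≡ x
∈-endpoint (inj₁ xz∈F) = (Any.index xz∈F , 0F) , cong proj₁ (≡-sym (lookup-index xz∈F))
∈-endpoint (inj₂ zx∈F) = (Any.index zx∈F , 1F) , cong proj₂ (≡-sym (lookup-index zx∈F))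

-- Of the two cycle edges at a leaf at most one is an edge of G, since a leaf has one neighbour.
leaf-endpoint : ∀ {N} (G : SimpleGraph N) F → Hamiltonian (AddEdges G F)
  → ∀ {x} → IsLeaf G x → ∃[ e ] endpoint F e ≡ x
leaf-endpoint G F (_ , c , cycle , spanning) {x} leaf with spanning x
... | j , refl with IsCycle-two-neighbours {A = AddEdges G F} (AddEdges-sym G F) c cycle j
... | u , w , u≢w , inj₂ ju∈F , _          = ∈-endpoint ju∈F
... | u , w , u≢w , inj₁ _    , inj₂ jw∈F = ∈-endpoint jw∈F
... | u , w , u≢w , inj₁ ju   , inj₁ jw   =
  ⊥-elim (u≢w (proj₁ (proj₂ cycle) (leaf-neighbour-unique G leaf ju jw)))

injective-×ʳ⇒≤ : ∀ {m k d} .{{_ : NonZero d}} {f : Fin m × Fin d → Fin k × Fin d}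
  → Injective _≡_ _≡_ f → m ≤ k
injective-×ʳ⇒≤ {m} {k} {d} {f} f-inj = *-cancelʳ-≤ m k d (injective⇒≤ g-inj)
  where
  g : Fin (m * d) → Fin (k * d)
  g z = uncurry combine (f (remQuot d z))
  g-inj : Injective _≡_ _≡_ g
  g-inj {z} {z′} e with combine-injective _ _ _ _ e
  ... | e₁ , e₂ = begin
    z                                   ≡⟨ combine-remQuot {m} d z ⟨
    uncurry combine (remQuot {m} d z)   ≡⟨ cong (uncurry combine) (f-inj (cong₂ _,_ e₁ e₂)) ⟩
    uncurry combine (remQuot {m} d z′)  ≡⟨ combine-remQuot {m} d z′ ⟩
    z′                                  ∎
    where open ≡-Reasoning

leaves≤length-completion : ∀ {N m} (G : SimpleGraph N) F → Hamiltonian (AddEdges G F)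
  → (ℓ : Fin m × Fin 2 → Fin N) → Injective _≡_ _≡_ ℓ → (∀ e → IsLeaf G (ℓ e))
  → m ≤ length F
leaves≤length-completion {m = m} G F H ℓ ℓ-inj ℓ-leaf = injective-×ʳ⇒≤ {f = at} at-inj
  where
  at : Fin m × Fin 2 → Fin (length F) × Fin 2
  at e = proj₁ (leaf-endpoint G F H (ℓ-leaf e))
  endpoint-at : ∀ e → endpoint F (at e) ≡ ℓ e
  endpoint-at e = proj₂ (leaf-endpoint G F H (ℓ-leaf e))
  at-inj : Injective _≡_ _≡_ at
  at-inj {e} {e′} eq =
    ℓ-inj (trans (≡-sym (endpoint-at e)) (trans (cong (endpoint F) eq) (endpoint-at e′)))

quot₃ : ℕ → ℕ
quot₃ (suc (suc (suc x))) = suc (quot₃ x)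
quot₃ _                   = 0

rem₃ : ℕ → Fin 3
rem₃ 0                   = 0F
rem₃ 1                   = 1F
rem₃ 2                   = 2F
rem₃ (suc (suc (suc x))) = rem₃ x

rem₃+quot₃*3≡id : ∀ x → toℕ (rem₃ x) + quot₃ x * 3 ≡ x
rem₃+quot₃*3≡id 0 = refl
rem₃+quot₃*3≡id 1 = refl
rem₃+quot₃*3≡id 2 = refl
rem₃+quot₃*3≡id (suc (suc (suc x))) =
  trans (x∙yz≈y∙xz (toℕ (rem₃ x)) 3 (quot₃ x * 3)) (cong (3 +_) (rem₃+quot₃*3≡id x))

quot₃-rem₃-inverse : ∀ q (r : Fin 3)
  → quot₃ (toℕ r + q * 3) ≡ q × rem₃ (toℕ r + q * 3) ≡ r
quot₃-rem₃-inverse zero    0F = refl , refl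
quot₃-rem₃-inverse zero    1F = refl , refl
quot₃-rem₃-inverse zero    2F = refl , refl
quot₃-rem₃-inverse (suc q) r rewrite x∙yz≈y∙xz (toℕ r) 3 (q * 3)
  with quot₃-rem₃-inverse q r
... | quot≡q , rem≡r = cong suc quot≡q , rem≡r

quot₃-rem₃-injective : ∀ {x y} → quot₃ x ≡ quot₃ y → rem₃ x ≡ rem₃ y → x ≡ y
quot₃-rem₃-injective {x} {y} quot≡ rem≡ = begin
  x                             ≡⟨ rem₃+quot₃*3≡id x ⟨
  toℕ (rem₃ x) + quot₃ x * 3    ≡⟨ cong₂ (λ r q → toℕ r + q * 3) rem≡ quot≡ ⟩
  toℕ (rem₃ y) + quot₃ y * 3    ≡⟨ rem₃+quot₃*3≡id y ⟩
  y                             ∎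
  where open ≡-Reasoning

quot₃-<-bound : ∀ {x q} → x < q * 3 → quot₃ x < q
quot₃-<-bound {x} {q} x<3q = *-cancelʳ-< 3 (quot₃ x) q
  (≤-<-trans (subst (quot₃ x * 3 ≤_) (rem₃+quot₃*3≡id x) (m≤n+m _ (toℕ (rem₃ x)))) x<3q)

blocks-consecutive : ∀ {X : Set} (R : X → X → Set) (block : ℕ → Fin 3 → X)
  → (∀ q → R (block q 0F) (block q 1F)) → (∀ q → R (block q 1F) (block q 2F))
  → (∀ q → R (block q 2F) (block (suc q) 0F))
  → ∀ x → R (block (quot₃ x) (rem₃ x)) (block (quot₃ (suc x)) (rem₃ (suc x)))
blocks-consecutive R block R₀₁ R₁₂ R₂₀ 0 = R₀₁ 0
blocks-consecutive R block R₀₁ R₁₂ R₂₀ 1 = R₁₂ 0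
blocks-consecutive R block R₀₁ R₁₂ R₂₀ 2 = R₂₀ 0
blocks-consecutive R block R₀₁ R₁₂ R₂₀ (suc (suc (suc x))) =
  blocks-consecutive R (λ q → block (suc q))
    (λ q → R₀₁ (suc q)) (λ q → R₁₂ (suc q)) (λ q → R₂₀ (suc q)) x

hamiltonian-from-sequence : ∀ {N} {A : Fin N → Fin N → Set} (m : ℕ) (f : ℕ → Fin N)
  → 2 ≤ m
  → (∀ {x y} → x ≤ m → y ≤ m → f x ≡ f y → x ≡ y)
  → (∀ {x} → x < m → A (f x) (f (suc x)))
  → A (f m) (f 0)
  → (∀ v → ∃[ x ] x ≤ m × f x ≡ v)
  → Hamiltonian A
hamiltonian-from-sequence {N} {A} m f 2≤m f-inj f-step f-close f-cover =
  m , c , (2≤m , c-inj , c-step , c-close) , c-cover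
  where
  c : Fin (suc m) → Fin N
  c k = f (toℕ k)
  c-inj : Injective _≡_ _≡_ c
  c-inj {k} {l} e = toℕ-injective (f-inj (toℕ≤pred[n] k) (toℕ≤pred[n] l) e)
  c-step : ∀ (k : Fin m) → A (c (inject₁ k)) (c (suc k))
  c-step k =
    subst (λ x → A (f x) (f (suc (toℕ k)))) (≡-sym (toℕ-inject₁ k)) (f-step (toℕ<n k))
  c-close : A (c (fromℕ m)) (c zero)
  c-close = subst (λ x → A (f x) (f 0)) (≡-sym (toℕ-fromℕ m)) f-close
  c-cover : ∀ v → ∃[ k ] c k ≡ v
  c-cover v with f-cover v
  ... | x , x≤m , fx≡v = fromℕ< (s≤s x≤m) , trans (cong f (toℕ-fromℕ< (s≤s x≤m))) fx≡v

suc-mod-mod : ∀ q n .{{_ : NonZero n}} → suc (toℕ (q mod n)) mod n ≡ suc q mod n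
suc-mod-mod q n = toℕ-injective (begin
  toℕ (suc (toℕ (q mod n)) mod n)  ≡⟨ toℕ-fromℕ< _ ⟩
  suc (toℕ (q mod n)) % n          ≡⟨ cong (λ t → suc t % n) (toℕ-fromℕ< _) ⟩
  suc (q % n) % n                  ≡⟨ %-distribˡ-+ 1 (q % n) n ⟩
  (1 % n + q % n % n) % n          ≡⟨ cong (λ t → (1 % n + t) % n) (m%n%n≡m%n q n) ⟩
  (1 % n + q % n) % n              ≡⟨ %-distribˡ-+ 1 q n ⟨
  suc q % n                        ≡⟨ toℕ-fromℕ< _ ⟨
  toℕ (suc q mod n)                ∎)
  where open ≡-Reasoning

mod-self : ∀ n → suc n mod suc n ≡ zero
mod-self n = toℕ-injective (trans (toℕ-fromℕ< _) (n%n≡0 (suc n)))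

toℕ-mod : ∀ {q n} .{{_ : NonZero n}} → q < n → toℕ (q mod n) ≡ q
toℕ-mod q<n = trans (toℕ-fromℕ< _) (m<n⇒m%n≡m q<n)

mod-toℕ : ∀ {n} (i : Fin (suc n)) → toℕ i mod suc n ≡ i
mod-toℕ i = toℕ-injective (toℕ-mod (toℕ<n i))

module TwoLeafCaterpillar {N n} (G : SimpleGraph N) (p : Fin (suc n) → Fin N)
  (p-inj : Injective _≡_ _≡_ p)
  (off-path : ∀ v → (∀ i → p i ≢ v) → IsLeaf G v × ∃[ i ] Adj G v (p i))
  (two-leaves : ∀ i → TwoLeaves G (p i)) where

  leaf : Fin (suc n) × Fin 2 → Fin N
  leaf (i , 0F) = proj₁ (two-leaves i)
  leaf (i , 1F) = proj₁ (proj₂ (two-leaves i))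

  leaf-isLeaf : ∀ e → IsLeaf G (leaf e)
  leaf-isLeaf (i , 0F) = let (_ , _ , _ , a-leaf , _) = two-leaves i in a-leaf
  leaf-isLeaf (i , 1F) = let (_ , _ , _ , _ , b-leaf , _) = two-leaves i in b-leaf

  leaf-adj : ∀ i s → Adj G (p i) (leaf (i , s))
  leaf-adj i 0F = let (_ , _ , _ , _ , _ , pa , _) = two-leaves i in pa
  leaf-adj i 1F = let (_ , _ , _ , _ , _ , _ , pb , _) = two-leaves i in pb

  leaf-complete : ∀ i w → Adj G (p i) w → IsLeaf G w
    → w ≡ leaf (i , 0F) ⊎ w ≡ leaf (i , 1F)
  leaf-complete i = let (_ , _ , _ , _ , _ , _ , _ , complete) = two-leaves i in complete

  leaf-sides-distinct : ∀ i → leaf (i , 0F) ≢ leaf (i , 1F)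
  leaf-sides-distinct i = let (_ , _ , a≢b , _) = two-leaves i in a≢b

  path-not-leaf : ∀ i → ¬ IsLeaf G (p i)
  path-not-leaf i (_ , _ , only) =
    leaf-sides-distinct i (trans (only _ (leaf-adj i 0F)) (≡-sym (only _ (leaf-adj i 1F))))

  leaf≢path : ∀ e j → leaf e ≢ p j
  leaf≢path e j e≡j = path-not-leaf j (subst (IsLeaf G) e≡j (leaf-isLeaf e))

  leaf-injective : Injective _≡_ _≡_ leaf
  leaf-injective {i , s} {j , t} eq
    with refl ← p-inj (leaf-neighbour-unique G (leaf-isLeaf (j , t))
                        (SimpleGraph.sym G (subst (Adj G (p i)) eq (leaf-adj i s)))
                        (SimpleGraph.sym G (leaf-adj j t)))
    = cong (i ,_) (side-injective s t eq)
    where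
    side-injective : ∀ s t → leaf (i , s) ≡ leaf (i , t) → s ≡ t
    side-injective 0F 0F _ = refl
    side-injective 0F 1F e = ⊥-elim (leaf-sides-distinct i e)
    side-injective 1F 0F e = ⊥-elim (leaf-sides-distinct i (≡-sym e))
    side-injective 1F 1F _ = refl

  next : Fin (suc n) → Fin (suc n)
  next i = suc (toℕ i) mod suc n

  added-edge : Fin (suc n) → Fin N × Fin N
  added-edge i = leaf (i , 1F) , leaf (next i , 0F)

  added : List (Fin N × Fin N)
  added = tabulate added-edge

  added-valid : ValidAddition G added
  added-valid = All.tabulate⁺ (λ i → right≢left , right≁left i) , AllPairs.tabulate⁺ distinct
    where
    right≢left : ∀ {i j} → leaf (i , 1F) ≢ leaf (j , 0F)
    right≢left {i} {j} e with () ← cong proj₂ (leaf-injective {i , 1F} {j , 0F} e)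
    right≁left : ∀ i → ¬ Adj G (leaf (i , 1F)) (leaf (next i , 0F))
    right≁left i adj = leaf≢path (next i , 0F) i
      (leaf-neighbour-unique G (leaf-isLeaf (i , 1F)) adj (SimpleGraph.sym G (leaf-adj i 1F)))
    distinct : ∀ {i j} → i ≢ j → ¬ SameEdge (added-edge i) (added-edge j)
    distinct {i} {j} i≢j (inj₁ (b≡b′ , _)) =
      i≢j (cong proj₁ (leaf-injective {i , 1F} {j , 1F} b≡b′))
    distinct i≢j (inj₂ (b≡a′ , _)) = right≢left b≡a′

  visit : Fin (suc n) → Fin 3 → Fin N
  visit i 0F = leaf (i , 0F)
  visit i 1F = p i
  visit i 2F = leaf (i , 1F)

  visit-injective : ∀ {i j} r s → visit i r ≡ visit j s → i ≡ j × r ≡ s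
  visit-injective {i} {j} 0F 0F e with refl ← leaf-injective {i , 0F} {j , 0F} e = refl , refl
  visit-injective {i} {j} 0F 2F e with () ← leaf-injective {i , 0F} {j , 1F} e
  visit-injective {i} {j} 2F 0F e with () ← leaf-injective {i , 1F} {j , 0F} e
  visit-injective {i} {j} 2F 2F e with refl ← leaf-injective {i , 1F} {j , 1F} e = refl , refl
  visit-injective {i} {j} 1F 1F e = p-inj e , refl
  visit-injective {i} {j} 0F 1F e = ⊥-elim (leaf≢path (i , 0F) j e)
  visit-injective {i} {j} 2F 1F e = ⊥-elim (leaf≢path (i , 1F) j e)
  visit-injective {i} {j} 1F 0F e = ⊥-elim (leaf≢path (j , 0F) i (≡-sym e))
  visit-injective {i} {j} 1F 2F e = ⊥-elim (leaf≢path (j , 1F) i (≡-sym e))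

  visit-surjective : ∀ v → ∃[ i ] ∃[ r ] visit i r ≡ v
  visit-surjective v with any? (λ i → p i ≟ v)
  ... | yes (i , pi≡v) = i , 1F , pi≡v
  ... | no off with off-path v (λ i pi≡v → off (i , pi≡v))
  ... | v-leaf , j , vj with leaf-complete j v (SimpleGraph.sym G vj) v-leaf
  ... | inj₁ v≡a = j , 0F , ≡-sym v≡a
  ... | inj₂ v≡b = j , 2F , ≡-sym v≡b

  last : ℕ
  last = 2 + n * 3

  tour : ℕ → Fin N
  tour x = visit (quot₃ x mod suc n) (rem₃ x)

  tour-step : ∀ x → AddEdges G added (tour x) (tour (suc x))
  tour-step = blocks-consecutive (AddEdges G added) (λ q → visit (q mod suc n))
    (λ q → inj₁ (SimpleGraph.sym G (leaf-adj _ 0F)))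
    (λ q → inj₁ (leaf-adj _ 1F))
    (λ q → inj₂ (inj₁ (subst (λ k → (leaf (q mod suc n , 1F) , leaf (k , 0F)) ∈ added)
               (suc-mod-mod q (suc n)) (∈-tabulate⁺ {f = added-edge} (q mod suc n)))))

  tour-periodic : tour (suc last) ≡ tour 0
  tour-periodic with quot₃-rem₃-inverse (suc n) 0F
  ... | quot≡ , rem≡ = cong₂ visit (trans (cong (_mod suc n) quot≡) (mod-self n)) rem≡

  tour-visit : ∀ i r → tour (toℕ r + toℕ i * 3) ≡ visit i r
  tour-visit i r with quot₃-rem₃-inverse (toℕ i) r
  ... | quot≡ , rem≡ = cong₂ visit (trans (cong (_mod suc n) quot≡) (mod-toℕ i)) rem≡

  tour-injective : ∀ {x y} → x ≤ last → y ≤ last → tour x ≡ tour y → x ≡ y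
  tour-injective {x} {y} x≤last y≤last e with visit-injective (rem₃ x) (rem₃ y) e
  ... | block≡ , rem≡ = quot₃-rem₃-injective (begin
    quot₃ x                      ≡⟨ toℕ-mod (quot₃-<-bound (s≤s x≤last)) ⟨
    toℕ (quot₃ x mod suc n)      ≡⟨ cong toℕ block≡ ⟩
    toℕ (quot₃ y mod suc n)      ≡⟨ toℕ-mod (quot₃-<-bound (s≤s y≤last)) ⟩
    quot₃ y                      ∎) rem≡
    where open ≡-Reasoning

  tour-covers : ∀ v → ∃[ x ] x ≤ last × tour x ≡ v
  tour-covers v with visit-surjective v
  ... | i , r , visit≡v = toℕ r + toℕ i * 3
                        , +-mono-≤ (toℕ≤pred[n] r) (*-monoˡ-≤ 3 (toℕ≤pred[n] i))
                        , trans (tour-visit i r) visit≡v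

  added-hamiltonian : Hamiltonian (AddEdges G added)
  added-hamiltonian =
    hamiltonian-from-sequence {A = AddEdges G added} last tour (s≤s (s≤s z≤n)) tour-injective
      (λ {x} _ → tour-step x)
      (subst (AddEdges G added (tour last)) tour-periodic (tour-step last)) tour-covers

mainTheorem2 : (n : ℕ) → 1 ≤ n → (N : ℕ) (G : SimpleGraph N) (p : Fin n → Fin N)
    → IsCaterpillar G n p → (∀ (i : Fin n) → TwoLeaves G (p i))
    → HamCompletionNumber G n
mainTheorem2 (suc n) (s≤s z≤n) N G p (_ , p-inj , _ , off-path) two-leaves =
  (added , added-valid , length-tabulate added-edge , added-hamiltonian) ,
  λ F _ F-hamiltonian →
    leaves≤length-completion G F F-hamiltonian leaf leaf-injective leaf-isLeaf
  where open TwoLeafCaterpillar G p p-inj off-path two-leaves
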